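{- Let $T$ be a tree. Then for every dominating set $S$ of $T$, $|a(S)|\le 2\Gamma(T)-|S|$.
   Context: A dominating set of a graph $G=(V,E)$ is a set $S\subseteq V$ such that every vertex is in $S$ or adjacent to a vertex of $S$; it is minimal if no proper subset is dominating. $\Gamma(G)$ is the maximum size of a minimal dominating set. For a dominating set $S$, $a(S)=\{v\in S: S\setminus\{v\}\text{ is not a dominating set}\}$. -}

module Defs where

open import Data.Nat using (ℕ; _≤_; _+_; _*_; suc)
open import Data.Fin using (Fin)
open import Data.Fin.Subset using (Subset; _∈_; _∉_; _⊂_; _-_; ∣_∣)
open import Data.Bool using (Bool; true; false)
open import Data.List using (List; []; _∷_)
open import Data.List.Relation.Unary.Unique.Propositional using (Unique)
open import Data.Product using (Σ; ∃; ∃-syntax; _×_)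
open import Data.Sum using (_⊎_)
open import Relation.Nullary using (¬_)
open import Relation.Binary.PropositionalEquality using (_≡_)
open import Function.Bundles using (_⇔_)

record Graph (n : ℕ) : Set where
  field
    adj    : Fin n → Fin n → Bool
    sym    : ∀ u v → adj u v ≡ adj v u
    irrefl : ∀ v → adj v v ≡ false

module _ {n : ℕ} (G : Graph n) where
  open Graph G

  Adj : Fin n → Fin n → Set
  Adj u v = adj u v ≡ true

  data Walk : Fin n → Fin n → Set where
    here : ∀ {v} → Walk v v
    step : ∀ {u w v} → Adj u w → Walk w v → Walk u v

  Connected : Set
  Connected = ∀ u v → Walk u v

  PathList : Fin n → List (Fin n) → Fin n → Set
  PathList u []       v = u ≡ v
  PathList u (w ∷ ws) v = Adj u w × PathList w ws v

  -- a cycle: distinct vertices v₀ , v₁ , … , vₖ (k ≥ 2) with consecutive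
  -- vertices adjacent and vₖ adjacent to v₀
  Cycle : Set
  Cycle = Σ (Fin n) λ v₀ → Σ (Fin n) λ v₁ → Σ (Fin n) λ v₂ →
          Σ (List (Fin n)) λ rest → Σ (Fin n) λ vₖ →
            Unique (v₀ ∷ v₁ ∷ v₂ ∷ rest) ×
            Adj v₀ v₁ × PathList v₁ (v₂ ∷ rest) vₖ × Adj vₖ v₀

  Acyclic : Set
  Acyclic = ¬ Cycle

  IsTree : Set
  IsTree = (1 ≤ n) × Connected × Acyclic

  Dominating : Subset n → Set
  Dominating S = ∀ v → v ∈ S ⊎ (∃[ u ] (u ∈ S × Adj u v))

  MinimalDominating : Subset n → Set
  MinimalDominating S = Dominating S × (∀ S′ → S′ ⊂ S → ¬ Dominating S′)

  IsUpperDomination : ℕ → Set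
  IsUpperDomination k =
    (∃[ S ] (MinimalDominating S × ∣ S ∣ ≡ k)) ×
    (∀ S → MinimalDominating S → ∣ S ∣ ≤ k)

  IsA : Subset n → Subset n → Set
  IsA S A = ∀ v → (v ∈ A) ⇔ (v ∈ S × ¬ Dominating (S - v))

{-# OPTIONS --safe #-}
module Submission where

-- Let A₂ be the vertices of a(S) without a neighbour in S, and A₁ = a(S) ∖ A₂. A vertex x ∈ A₁
-- dominates itself through S ∖ {x}, so S ∖ {x} misses an external private neighbour of x: a
-- vertex outside S whose only neighbour in S is x. These are distinct for distinct x and lie in
-- the set Q of vertices outside S at distance at least 2 from A₂, so |A₁| ≤ |Q|. Properly
-- 2-colour the tree; for each colour b, A₂ together with the vertices of colour b at distance at
-- least 2 from A₂ is independent, hence extends to a maximal independent set, i.e. a minimal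
-- dominating set, and has at most Γ elements. The two sets I₀, I₁ so obtained satisfy
-- A₂ ⊆ I₀ ∩ I₁ and S ∪ Q ⊆ I₀ ∪ I₁, whence
--   |a(S)| + |S| + |Q| ≤ |A₁| + |A₂| + |S ∪ Q| ≤ |Q| + |I₀ ∩ I₁| + |I₀ ∪ I₁| ≤ |Q| + 2Γ.

open import Defs
open import Data.Nat using (ℕ; zero; suc; _≤_; _<_; _+_; _*_; z≤n; s≤s; z<s)
open import Data.Fin.Subset
  using (Subset; ∣_∣; _∈_; _∉_; _⊆_; _⊂_; _-_; _∩_; _∪_; ∁; ⁅_⁆; Empty; inside; outside)

open import Data.Bool using (Bool; true; false; not; _xor_)
open import Data.Bool.Properties using (not-distribˡ-xor; not-distribʳ-xor; xor-same)
  renaming (_≟_ to _≟ᵇ_)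
open import Data.Fin using (Fin; zero; suc; fromℕ<)
open import Data.Fin.Properties using (any?; ¬∀⟶∃¬; 0≢1+n; suc-injective)
  renaming (_≟_ to _≟ᶠ_)
open import Data.Fin.Subset.Properties
  using ( _∈?_; x∈p∩q⁺; x∈p∩q⁻; x∈p∪q⁺; x∈p∪q⁻; p⊆p∪q; q⊆p∪q; x∈⁅x⁆; x∈⁅y⁆⇒x≡y
        ; x∈∁p⇒x∉p; x∉p⇒x∈∁p; x∈p∧x≢y⇒x∈p-y; x∈p⇒∣p-x∣<∣p∣; p⊆q⇒∣p∣≤∣q∣
        ; ⊆-refl; ⊆-trans; Empty-unique; ∣⊥∣≡0 )
open import Data.List using (List; []; _∷_; _++_; [_]; length; allFin)
open import Data.List.Properties using (length-++)
open import Data.List.Membership.Propositional.Properties using (∈-∃++; ∈-allFin)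
import Data.List.Membership.DecPropositional as DecMembership
open import Data.List.Relation.Unary.All using (All; []; _∷_)
import Data.List.Relation.Unary.All as All
open import Data.List.Relation.Unary.All.Properties using (¬Any⇒All¬)
open import Data.List.Relation.Unary.AllPairs using ([]; _∷_)
open import Data.List.Relation.Unary.Unique.Propositional using (Unique)
open import Data.Nat.Induction using (<-wellFounded)
open import Data.Nat.Properties
  using ( module ≤-Reasoning; ≤-trans; m≤n+m; m<m+n; m<n+m
        ; +-suc; +-assoc; +-comm; +-identityʳ; +-mono-≤; +-monoˡ-≤; +-cancelʳ-≤ )
open import Data.Nat.Tactic.RingSolver using (solve-∀)
open import Data.Product using (∃₂; ∃-syntax; Σ-syntax; _×_; _,_; proj₁; proj₂)
open import Data.Sum using (_⊎_; inj₁; inj₂)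
open import Data.Vec using ([]; _∷_; tabulate; here; there)
open import Data.Vec.Properties using (lookup∘tabulate; []=⇒lookup; lookup⇒[]=)
open import Function using (_∘_; case_of_)
open import Function.Bundles using (Equivalence)
open import Induction.WellFounded using (Acc; acc)
open import Relation.Binary.Definitions using (DecidableEquality)
open import Relation.Binary.PropositionalEquality
  using (_≡_; _≢_; refl; sym; trans; cong; cong₂; subst; module ≡-Reasoning)
open import Relation.Nullary using (¬_; Dec; yes; no; does; contradiction)
open import Relation.Nullary.Decidable using (dec-true; _⊎-dec_; _×-dec_)
open import Relation.Unary using (Pred; Decidable)

parity : ℕ → Bool
parity zero    = false
parity (suc n) = not (parity n)

parity-+ : ∀ m n → parity (m + n) ≡ parity m xor parity n
parity-+ zero    n = refl
parity-+ (suc m) n = trans (cong not (parity-+ m n)) (not-distribˡ-xor (parity m) (parity n))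

parity-+-true : ∀ m n → parity (m + n) ≡ true → parity m ≡ true ⊎ parity n ≡ true
parity-+-true m n odd with parity m | parity-+ m n
... | true  | _  = inj₁ refl
... | false | eq = inj₂ (trans (sym eq) odd)

xor-not-self : ∀ b → b xor not b ≡ true
xor-not-self b = trans (sym (not-distribʳ-xor b b)) (cong not (xor-same b))

module _ {a} {A : Set a} where

  Duplicate : List A → Set a
  Duplicate xs = ∃₂ λ (d : A) (ps : List A) → ∃₂ λ qs rs → xs ≡ ps ++ d ∷ qs ++ d ∷ rs

  unique⊎duplicate : DecidableEquality A → (xs : List A) → Unique xs ⊎ Duplicate xs
  unique⊎duplicate _≟_ []       = inj₁ []
  unique⊎duplicate _≟_ (x ∷ xs) with DecMembership._∈?_ _≟_ x xs
  ... | yes x∈xs = let qs , rs , eq = ∈-∃++ x∈xs in inj₂ (x , [] , qs , rs , cong (x ∷_) eq)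
  ... | no  x∉xs with unique⊎duplicate _≟_ xs
  ...   | inj₁ uniq                 = inj₁ (¬Any⇒All¬ xs x∉xs ∷ uniq)
  ...   | inj₂ (d , ps , qs , rs , eq) = inj₂ (d , x ∷ ps , qs , rs , cong (x ∷_) eq)

  length-removeLoop : ∀ (ps qs rs : List A) d →
    length (ps ++ d ∷ qs ++ d ∷ rs) ≡ length (qs ++ [ d ]) + length (ps ++ d ∷ rs)
  length-removeLoop ps qs rs d = begin
    length (ps ++ d ∷ qs ++ d ∷ rs)                ≡⟨ length-++ ps ⟩
    length ps + suc (length (qs ++ d ∷ rs))        ≡⟨ cong (λ k → length ps + suc k) (length-++ qs) ⟩
    length ps + suc (length qs + suc (length rs))  ≡⟨ rearrange (length ps) (length qs) (length rs) ⟩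
    (length qs + 1) + (length ps + suc (length rs)) ≡⟨ sym (cong₂ _+_ (length-++ qs) (length-++ ps)) ⟩
    length (qs ++ [ d ]) + length (ps ++ d ∷ rs)   ∎
    where
    open ≡-Reasoning
    rearrange : ∀ a b c → a + suc (b + suc c) ≡ (b + 1) + (a + suc c)
    rearrange = solve-∀

  0<length-++-∷ : ∀ (xs : List A) {y ys} → 0 < length (xs ++ y ∷ ys)
  0<length-++-∷ []      = z<s
  0<length-++-∷ (_ ∷ _) = z<s

  length-loop< : ∀ (ps qs rs : List A) d → length (qs ++ [ d ]) < length (ps ++ d ∷ qs ++ d ∷ rs)
  length-loop< ps qs rs d =
    subst (length (qs ++ [ d ]) <_) (sym (length-removeLoop ps qs rs d)) (m<m+n _ (0<length-++-∷ ps))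

  length-rest< : ∀ (ps qs rs : List A) d → length (ps ++ d ∷ rs) < length (ps ++ d ∷ qs ++ d ∷ rs)
  length-rest< ps qs rs d =
    subst (length (ps ++ d ∷ rs) <_) (sym (length-removeLoop ps qs rs d)) (m<n+m _ (0<length-++-∷ qs))

module _ {n ℓ} {P : Pred (Fin n) ℓ} (P? : Decidable P) where

  toSubset : Subset n
  toSubset = tabulate (does ∘ P?)

  ∈-toSubset⁺ : ∀ {x} → P x → x ∈ toSubset
  ∈-toSubset⁺ {x} px = lookup⇒[]= x toSubset (trans (lookup∘tabulate (does ∘ P?) x) (dec-true (P? x) px))

  ∈-toSubset⁻ : ∀ {x} → x ∈ toSubset → P x
  ∈-toSubset⁻ {x} x∈ with P? x | trans (sym (lookup∘tabulate (does ∘ P?) x)) ([]=⇒lookup x∈)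
  ... | yes px | _  = px
  ... | no  _  | ()

∣p∩q∣+∣p∪q∣≡∣p∣+∣q∣ : ∀ {n} (p q : Subset n) → ∣ p ∩ q ∣ + ∣ p ∪ q ∣ ≡ ∣ p ∣ + ∣ q ∣
∣p∩q∣+∣p∪q∣≡∣p∣+∣q∣ []            []            = refl
∣p∩q∣+∣p∪q∣≡∣p∣+∣q∣ (inside  ∷ p) (inside  ∷ q) =
  cong suc (trans (+-suc ∣ p ∩ q ∣ ∣ p ∪ q ∣)
                  (trans (cong suc (∣p∩q∣+∣p∪q∣≡∣p∣+∣q∣ p q)) (sym (+-suc ∣ p ∣ ∣ q ∣))))
∣p∩q∣+∣p∪q∣≡∣p∣+∣q∣ (inside  ∷ p) (outside ∷ q) =
  trans (+-suc ∣ p ∩ q ∣ ∣ p ∪ q ∣) (cong suc (∣p∩q∣+∣p∪q∣≡∣p∣+∣q∣ p q))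
∣p∩q∣+∣p∪q∣≡∣p∣+∣q∣ (outside ∷ p) (inside  ∷ q) =
  trans (+-suc ∣ p ∩ q ∣ ∣ p ∪ q ∣)
        (trans (cong suc (∣p∩q∣+∣p∪q∣≡∣p∣+∣q∣ p q)) (sym (+-suc ∣ p ∣ ∣ q ∣)))
∣p∩q∣+∣p∪q∣≡∣p∣+∣q∣ (outside ∷ p) (outside ∷ q) = ∣p∩q∣+∣p∪q∣≡∣p∣+∣q∣ p q

∣p∪q∣≤∣p∣+∣q∣ : ∀ {n} (p q : Subset n) → ∣ p ∪ q ∣ ≤ ∣ p ∣ + ∣ q ∣
∣p∪q∣≤∣p∣+∣q∣ p q = subst (∣ p ∪ q ∣ ≤_) (∣p∩q∣+∣p∪q∣≡∣p∣+∣q∣ p q) (m≤n+m ∣ p ∪ q ∣ ∣ p ∩ q ∣)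

Empty[p∩q]⇒∣p∪q∣≡∣p∣+∣q∣ : ∀ {n} (p q : Subset n) → Empty (p ∩ q) → ∣ p ∪ q ∣ ≡ ∣ p ∣ + ∣ q ∣
Empty[p∩q]⇒∣p∪q∣≡∣p∣+∣q∣ {n} p q empty = begin
  ∣ p ∪ q ∣               ≡⟨ cong (_+ ∣ p ∪ q ∣) (sym ∣p∩q∣≡0) ⟩
  ∣ p ∩ q ∣ + ∣ p ∪ q ∣   ≡⟨ ∣p∩q∣+∣p∪q∣≡∣p∣+∣q∣ p q ⟩
  ∣ p ∣ + ∣ q ∣           ∎
  where
  open ≡-Reasoning
  ∣p∩q∣≡0 : ∣ p ∩ q ∣ ≡ 0
  ∣p∩q∣≡0 = trans (cong ∣_∣ (Empty-unique empty)) (∣⊥∣≡0 n)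

injection⇒∣p∣≤∣q∣ : ∀ {m n ℓ} {p : Subset m} {q : Subset n} (R : Fin m → Fin n → Set ℓ) →
                    (∀ {x} → x ∈ p → ∃[ y ] (y ∈ q × R x y)) →
                    (∀ {x x′ y} → x ∈ p → x′ ∈ p → R x y → R x′ y → x ≡ x′) →
                    ∣ p ∣ ≤ ∣ q ∣
injection⇒∣p∣≤∣q∣ {p = []}          R total injective = z≤n
injection⇒∣p∣≤∣q∣ {p = outside ∷ p} R total injective =
  injection⇒∣p∣≤∣q∣ {p = p} (R ∘ suc) (total ∘ there)
    (λ x∈p x′∈p r r′ → suc-injective (injective (there x∈p) (there x′∈p) r r′))
injection⇒∣p∣≤∣q∣ {p = inside ∷ p} {q} R total injective with total here
... | y , y∈q , R0y =
  ≤-trans (s≤s (injection⇒∣p∣≤∣q∣ {p = p} {q - y} (R ∘ suc) total′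
                 (λ x∈p x′∈p r r′ → suc-injective (injective (there x∈p) (there x′∈p) r r′))))
          (x∈p⇒∣p-x∣<∣p∣ y∈q)
  where
  total′ : ∀ {x} → x ∈ p → ∃[ y′ ] (y′ ∈ q - y × R (suc x) y′)
  total′ x∈p with y′ , y′∈q , R1y′ ← total (there x∈p) =
    y′ , x∈p∧x≢y⇒x∈p-y y′∈q (λ { refl → 0≢1+n (injective here (there x∈p) R0y R1y′) }) , R1y′

module _ {n : ℕ} (G : Graph n) where
  open Graph G using (adj; irrefl)

  Adj-sym : ∀ {u v} → Adj G u v → Adj G v u
  Adj-sym {u} {v} u~v = trans (Graph.sym G v u) u~v

  Adj-irrefl : ∀ {v} → ¬ Adj G v v
  Adj-irrefl {v} v~v = contradiction (trans (sym v~v) (irrefl v)) λ ()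

  Adj? : ∀ u v → Dec (Adj G u v)
  Adj? u v = adj u v ≟ᵇ true

  HasNeighbourIn : Subset n → Fin n → Set
  HasNeighbourIn X v = ∃[ u ] (u ∈ X × Adj G u v)

  hasNeighbourIn? : ∀ X v → Dec (HasNeighbourIn X v)
  hasNeighbourIn? X v = any? (λ u → u ∈? X ×-dec Adj? u v)

  neighbours : Subset n → Subset n
  neighbours X = toSubset (hasNeighbourIn? X)

  ∈-neighbours⁺ : ∀ {X u v} → u ∈ X → Adj G u v → v ∈ neighbours X
  ∈-neighbours⁺ {X} u∈X u~v = ∈-toSubset⁺ (hasNeighbourIn? X) (_ , u∈X , u~v)

  ∈-neighbours⁻ : ∀ {X v} → v ∈ neighbours X → HasNeighbourIn X v
  ∈-neighbours⁻ {X} = ∈-toSubset⁻ (hasNeighbourIn? X)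

  Dominates : Subset n → Fin n → Set
  Dominates S v = v ∈ S ⊎ HasNeighbourIn S v

  dominates? : ∀ S v → Dec (Dominates S v)
  dominates? S v = v ∈? S ⊎-dec hasNeighbourIn? S v

  dominates-mono : ∀ {S S′ v} → S ⊆ S′ → Dominates S v → Dominates S′ v
  dominates-mono S⊆S′ (inj₁ v∈S)            = inj₁ (S⊆S′ v∈S)
  dominates-mono S⊆S′ (inj₂ (u , u∈S , u~v)) = inj₂ (u , S⊆S′ u∈S , u~v)

  Independent : Subset n → Set
  Independent I = ∀ {u v} → u ∈ I → v ∈ I → ¬ Adj G u v

  ∪⁅⁆-independent : ∀ {I v} → Independent I → ¬ Dominates I v → Independent (I ∪ ⁅ v ⁆)
  ∪⁅⁆-independent {I} {v} indep ¬dom u∈ w∈ u~w with x∈p∪q⁻ I ⁅ v ⁆ u∈ | x∈p∪q⁻ I ⁅ v ⁆ w∈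
  ... | inj₁ u∈I | inj₁ w∈I = indep u∈I w∈I u~w
  ... | inj₁ u∈I | inj₂ w∈v with refl ← x∈⁅y⁆⇒x≡y v w∈v = ¬dom (inj₂ (_ , u∈I , u~w))
  ... | inj₂ u∈v | inj₁ w∈I with refl ← x∈⁅y⁆⇒x≡y v u∈v = ¬dom (inj₂ (_ , w∈I , Adj-sym u~w))
  ... | inj₂ u∈v | inj₂ w∈v with refl ← x∈⁅y⁆⇒x≡y v u∈v | refl ← x∈⁅y⁆⇒x≡y v w∈v = Adj-irrefl u~w

  independent-dominate : ∀ {I} v → Independent I →
                         ∃[ J ] (I ⊆ J × Independent J × Dominates J v)
  independent-dominate {I} v indep with dominates? I v
  ... | yes dom = I , ⊆-refl , indep , dom
  ... | no ¬dom = I ∪ ⁅ v ⁆ , p⊆p∪q ⁅ v ⁆ , ∪⁅⁆-independent indep ¬dom , inj₁ (q⊆p∪q I ⁅ v ⁆ (x∈⁅x⁆ v))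

  independent-dominateAll : ∀ {I} vs → Independent I →
                            ∃[ J ] (I ⊆ J × Independent J × All (Dominates J) vs)
  independent-dominateAll []       indep = _ , ⊆-refl , indep , []
  independent-dominateAll (v ∷ vs) indep
    with J , I⊆J , indepJ , domJv ← independent-dominate v indep
    with K , J⊆K , indepK , domK  ← independent-dominateAll vs indepJ
    = K , ⊆-trans I⊆J J⊆K , indepK , dominates-mono J⊆K domJv ∷ domK

  independent∧dominating⇒minimalDominating : ∀ {M} → Independent M → Dominating G M →
                                             MinimalDominating G M
  independent∧dominating⇒minimalDominating {M} indep dom = dom , minimal
    where
    minimal : ∀ S′ → S′ ⊂ M → ¬ Dominating G S′
    minimal S′ (S′⊆M , x , x∈M , x∉S′) domS′ with domS′ x
    ... | inj₁ x∈S′              = x∉S′ x∈S′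
    ... | inj₂ (u , u∈S′ , u~x) = indep (S′⊆M u∈S′) x∈M u~x

  ∣independent∣≤Γ : ∀ {Γ I} → (∀ S → MinimalDominating G S → ∣ S ∣ ≤ Γ) → Independent I → ∣ I ∣ ≤ Γ
  ∣independent∣≤Γ maxΓ indep with M , I⊆M , indepM , domM ← independent-dominateAll (allFin n) indep =
    ≤-trans (p⊆q⇒∣p∣≤∣q∣ I⊆M)
            (maxΓ M (independent∧dominating⇒minimalDominating indepM (All.lookup domM ∘ ∈-allFin)))

  ExternalPrivateNeighbour : Subset n → Fin n → Fin n → Set
  ExternalPrivateNeighbour S x w = w ∉ S × Adj G x w × (∀ {u} → u ∈ S → Adj G u w → u ≡ x)

  undominated⇒externalPrivateNeighbour : ∀ {S x w} → Dominating G S → x ∈ neighbours S →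
                                         ¬ Dominates (S - x) w → ExternalPrivateNeighbour S x w
  undominated⇒externalPrivateNeighbour {S} {x} {w} domS x∈NS ¬dom = w∉S , x~w , onlyX
    where
    onlyX : ∀ {u} → u ∈ S → Adj G u w → u ≡ x
    onlyX {u} u∈S u~w with u ≟ᶠ x
    ... | yes u≡x = u≡x
    ... | no  u≢x = contradiction (inj₂ (u , x∈p∧x≢y⇒x∈p-y u∈S u≢x , u~w)) ¬dom
    w∉S : w ∉ S
    w∉S w∈S with w ≟ᶠ x
    ... | no w≢x = ¬dom (inj₁ (x∈p∧x≢y⇒x∈p-y w∈S w≢x))
    ... | yes refl with u , u∈S , u~x ← ∈-neighbours⁻ x∈NS with refl ← onlyX u∈S u~x = Adj-irrefl u~x
    x~w : Adj G x w
    x~w with domS w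
    ... | inj₁ w∈S              = contradiction w∈S w∉S
    ... | inj₂ (u , u∈S , u~w) with refl ← onlyX u∈S u~w = u~w

  externalPrivateNeighbour : ∀ {S x} → Dominating G S → x ∈ neighbours S → ¬ Dominating G (S - x) →
                             ∃[ w ] ExternalPrivateNeighbour S x w
  externalPrivateNeighbour {S} {x} domS x∈NS ¬domS-x
    with w , ¬dom ← ¬∀⟶∃¬ n (Dominates (S - x)) (dominates? (S - x)) ¬domS-x
    = w , undominated⇒externalPrivateNeighbour domS x∈NS ¬dom

  PathList-++⁺ : ∀ {u v w} xs {ys} → PathList G u xs v → PathList G v ys w → PathList G u (xs ++ ys) w
  PathList-++⁺ []       refl      q = q
  PathList-++⁺ (x ∷ xs) (u~x , p) q = u~x , PathList-++⁺ xs p q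

  PathList-++⁻ : ∀ {u w} xs {ys} → PathList G u (xs ++ ys) w →
                 ∃[ v ] (PathList G u xs v × PathList G v ys w)
  PathList-++⁻ []       p         = _ , refl , p
  PathList-++⁻ (x ∷ xs) (u~x , p) with v , p₁ , p₂ ← PathList-++⁻ xs p = v , (u~x , p₁) , p₂

  PathList-reverse : ∀ {u v} xs → PathList G u xs v →
                     ∃[ ys ] (length ys ≡ length xs × PathList G v ys u)
  PathList-reverse []       refl      = [] , refl , refl
  PathList-reverse {u} (x ∷ xs) (u~x , p) with ys , len , q ← PathList-reverse xs p =
    ys ++ [ u ] , trans (length-++ ys) (trans (+-comm (length ys) 1) (cong suc len)) ,
    PathList-++⁺ ys q (Adj-sym u~x , refl)

  walk⇒PathList : ∀ {u v} → Walk G u v → ∃[ xs ] PathList G u xs v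
  walk⇒PathList here          = [] , refl
  walk⇒PathList (step u~w wk) with xs , p ← walk⇒PathList wk = _ ∷ xs , u~w , p

  uniqueOddClosedWalk⇒cycle : ∀ {x} xs → Unique xs → parity (length xs) ≡ true →
                              PathList G x xs x → Cycle G
  uniqueOddClosedWalk⇒cycle (v ∷ [])                uniq odd (x~v , refl) = contradiction x~v Adj-irrefl
  uniqueOddClosedWalk⇒cycle {x} (v₁ ∷ v₂ ∷ v₃ ∷ vs) uniq odd (x~v₁ , v₁~v₂ , p) =
    v₁ , v₂ , v₃ , vs , x , uniq , v₁~v₂ , p , x~v₁

  closedWalk-removeLoop : ∀ {x} ps qs rs d → PathList G x (ps ++ d ∷ qs ++ d ∷ rs) x →
                          PathList G d (qs ++ [ d ]) d × PathList G x (ps ++ d ∷ rs) x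
  closedWalk-removeLoop ps qs rs d p
    with v , p₁ , (v~d , p₂) ← PathList-++⁻ ps p
    with w , q₁ , (w~d , q₂) ← PathList-++⁻ qs p₂
    = PathList-++⁺ qs q₁ (w~d , refl) , PathList-++⁺ ps p₁ (v~d , q₂)

  -- Cutting at a repeated vertex splits a closed walk into two shorter closed walks whose
  -- lengths add up to the original one, so one of them is again odd.
  oddClosedWalk⇒cycle : ∀ {x} xs → parity (length xs) ≡ true → PathList G x xs x → Cycle G
  oddClosedWalk⇒cycle xs = go xs (<-wellFounded (length xs))
    where
    go : ∀ {x} xs → Acc _<_ (length xs) → parity (length xs) ≡ true → PathList G x xs x → Cycle G
    go xs (acc rec) odd p with unique⊎duplicate _≟ᶠ_ xs
    ... | inj₁ uniq = uniqueOddClosedWalk⇒cycle xs uniq odd p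
    ... | inj₂ (d , ps , qs , rs , refl)
      with loop , rest ← closedWalk-removeLoop ps qs rs d p
      with parity-+-true (length (qs ++ [ d ])) (length (ps ++ d ∷ rs))
             (trans (cong parity (sym (length-removeLoop ps qs rs d))) odd)
    ... | inj₁ loop-odd = go _ (rec (length-loop< ps qs rs d)) loop-odd loop
    ... | inj₂ rest-odd = go _ (rec (length-rest< ps qs rs d)) rest-odd rest

  sameParity⇒oddClosedWalk : ∀ {r u v} xs ys → PathList G r xs u → PathList G r ys v → Adj G u v →
                             parity (length xs) ≡ parity (length ys) →
                             ∃[ zs ] (parity (length zs) ≡ true × PathList G r zs r)
  sameParity⇒oddClosedWalk {v = v} xs ys p q u~v same
    with ys′ , len , q′ ← PathList-reverse ys q
    = xs ++ v ∷ ys′ , odd , PathList-++⁺ xs p (u~v , q′)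
    where
    open ≡-Reasoning
    odd : parity (length (xs ++ v ∷ ys′)) ≡ true
    odd = begin
      parity (length (xs ++ v ∷ ys′))                      ≡⟨ cong parity (length-++ xs) ⟩
      parity (length xs + suc (length ys′))               ≡⟨ parity-+ (length xs) (suc (length ys′)) ⟩
      parity (length xs) xor not (parity (length ys′))    ≡⟨ cong₂ (λ a b → a xor not (parity b)) same len ⟩
      parity (length ys) xor not (parity (length ys))     ≡⟨ xor-not-self (parity (length ys)) ⟩
      true                                                ∎

  Bipartite : Set
  Bipartite = Σ[ colour ∈ (Fin n → Bool) ] (∀ {u v} → Adj G u v → colour u ≢ colour v)

  tree⇒bipartite : IsTree G → Bipartite
  tree⇒bipartite (1≤n , connected , acyclic) = colour , proper
    where
    root : Fin n
    root = fromℕ< 1≤n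
    rootPath : ∀ v → ∃[ xs ] PathList G root xs v
    rootPath v = walk⇒PathList (connected root v)
    colour : Fin n → Bool
    colour v = parity (length (proj₁ (rootPath v)))
    proper : ∀ {u v} → Adj G u v → colour u ≢ colour v
    proper {u} {v} u~v same
      with zs , odd , closed ← sameParity⇒oddClosedWalk _ _ (proj₂ (rootPath u)) (proj₂ (rootPath v)) u~v same
      = acyclic (oddClosedWalk⇒cycle zs odd closed)

module CriticalVertices {n} (T : Graph n) (S : Subset n) (domS : Dominating T S) (A : Subset n) (isA : IsA T S A)
                (colour : Fin n → Bool) (proper : ∀ {u v} → Adj T u v → colour u ≢ colour v) where

  A⊆S : A ⊆ S
  A⊆S {x} x∈A = proj₁ (Equivalence.to (isA x) x∈A)

  critical : ∀ {x} → x ∈ A → ¬ Dominating T (S - x)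
  critical {x} x∈A = proj₂ (Equivalence.to (isA x) x∈A)

  A₁ A₂ Far Q : Subset n
  A₁  = A ∩ neighbours T S
  A₂  = A ∩ ∁ (neighbours T S)
  Far = ∁ (A₂ ∪ neighbours T A₂)
  Q   = Far ∩ ∁ S

  colourClass : Bool → Subset n
  colourClass b = toSubset (λ v → colour v ≟ᵇ b)

  ∈-colourClass⁺ : ∀ x → x ∈ colourClass (colour x)
  ∈-colourClass⁺ x = ∈-toSubset⁺ (λ v → colour v ≟ᵇ colour x) refl

  ∈-colourClass⁻ : ∀ {b x} → x ∈ colourClass b → colour x ≡ b
  ∈-colourClass⁻ {b} = ∈-toSubset⁻ (λ v → colour v ≟ᵇ b)

  I : Bool → Subset n
  I b = A₂ ∪ (colourClass b ∩ Far)

  A₂⊆S : A₂ ⊆ S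
  A₂⊆S x∈A₂ = A⊆S (proj₁ (x∈p∩q⁻ A _ x∈A₂))

  A₂-S-nonadjacent : ∀ {u v} → u ∈ A₂ → v ∈ S → ¬ Adj T u v
  A₂-S-nonadjacent u∈A₂ v∈S u~v =
    x∈∁p⇒x∉p (proj₂ (x∈p∩q⁻ A _ u∈A₂)) (∈-neighbours⁺ T v∈S (Adj-sym T u~v))

  A₂-Far-nonadjacent : ∀ {u v} → u ∈ A₂ → v ∈ Far → ¬ Adj T u v
  A₂-Far-nonadjacent u∈A₂ v∈Far u~v = x∈∁p⇒x∉p v∈Far (x∈p∪q⁺ (inj₂ (∈-neighbours⁺ T u∈A₂ u~v)))

  I-independent : ∀ b → Independent T (I b)
  I-independent b {u} {v} u∈I v∈I u~v with x∈p∪q⁻ A₂ _ u∈I | x∈p∪q⁻ A₂ _ v∈I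
  ... | inj₁ u∈A₂ | inj₁ v∈A₂ = A₂-S-nonadjacent u∈A₂ (A₂⊆S v∈A₂) u~v
  ... | inj₁ u∈A₂ | inj₂ v∈CF = A₂-Far-nonadjacent u∈A₂ (proj₂ (x∈p∩q⁻ (colourClass b) Far v∈CF)) u~v
  ... | inj₂ u∈CF | inj₁ v∈A₂ = A₂-Far-nonadjacent v∈A₂ (proj₂ (x∈p∩q⁻ (colourClass b) Far u∈CF)) (Adj-sym T u~v)
  ... | inj₂ u∈CF | inj₂ v∈CF = proper u~v (trans (∈-colourClass⁻ (proj₁ (x∈p∩q⁻ _ Far u∈CF)))
                                                  (sym (∈-colourClass⁻ (proj₁ (x∈p∩q⁻ _ Far v∈CF)))))

  A₂⊆I∩I : A₂ ⊆ I false ∩ I true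
  A₂⊆I∩I x∈A₂ = x∈p∩q⁺ (p⊆p∪q _ x∈A₂ , p⊆p∪q _ x∈A₂)

  I⊆I∪I : ∀ b → I b ⊆ I false ∪ I true
  I⊆I∪I false = p⊆p∪q (I true)
  I⊆I∪I true  = q⊆p∪q (I false) (I true)

  Far⊆I∪I : Far ⊆ I false ∪ I true
  Far⊆I∪I {x} x∈Far =
    I⊆I∪I (colour x) (q⊆p∪q A₂ _ (x∈p∩q⁺ (∈-colourClass⁺ x , x∈Far)))

  S-A₂⊆Far : ∀ {x} → x ∈ S → x ∉ A₂ → x ∈ Far
  S-A₂⊆Far x∈S x∉A₂ = x∉p⇒x∈∁p λ x∈A₂∪N → case x∈p∪q⁻ A₂ _ x∈A₂∪N of λ
    { (inj₁ x∈A₂) → x∉A₂ x∈A₂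
    ; (inj₂ x∈N)  → let u , u∈A₂ , u~x = ∈-neighbours⁻ T x∈N in A₂-S-nonadjacent u∈A₂ x∈S u~x }

  S∪Q⊆I∪I : S ∪ Q ⊆ I false ∪ I true
  S∪Q⊆I∪I {x} x∈S∪Q with x∈p∪q⁻ S Q x∈S∪Q
  ... | inj₂ x∈Q = Far⊆I∪I (proj₁ (x∈p∩q⁻ Far _ x∈Q))
  ... | inj₁ x∈S with x ∈? A₂
  ...   | yes x∈A₂ = I⊆I∪I false (p⊆p∪q _ x∈A₂)
  ...   | no  x∉A₂ = Far⊆I∪I (S-A₂⊆Far x∈S x∉A₂)

  S∩Q-empty : Empty (S ∩ Q)
  S∩Q-empty (x , x∈S∩Q) = x∈∁p⇒x∉p (proj₂ (x∈p∩q⁻ Far _ (proj₂ (x∈p∩q⁻ S Q x∈S∩Q))))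
                                   (proj₁ (x∈p∩q⁻ S Q x∈S∩Q))

  A⊆A₁∪A₂ : A ⊆ A₁ ∪ A₂
  A⊆A₁∪A₂ {x} x∈A with x ∈? neighbours T S
  ... | yes x∈N = x∈p∪q⁺ (inj₁ (x∈p∩q⁺ (x∈A , x∈N)))
  ... | no  x∉N = x∈p∪q⁺ (inj₂ (x∈p∩q⁺ (x∈A , x∉p⇒x∈∁p x∉N)))

  privateNeighbour∈Q : ∀ {x w} → x ∈ A₁ → ExternalPrivateNeighbour T S x w → w ∈ Q
  privateNeighbour∈Q {x} {w} x∈A₁ (w∉S , x~w , onlyX) = x∈p∩q⁺ (x∉p⇒x∈∁p w∉A₂∪N , x∉p⇒x∈∁p w∉S)
    where
    w∉A₂∪N : w ∉ A₂ ∪ neighbours T A₂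
    w∉A₂∪N w∈A₂∪N with x∈p∪q⁻ A₂ _ w∈A₂∪N
    ... | inj₁ w∈A₂ = w∉S (A₂⊆S w∈A₂)
    ... | inj₂ w∈N with u , u∈A₂ , u~w ← ∈-neighbours⁻ T w∈N with refl ← onlyX (A₂⊆S u∈A₂) u~w =
      x∈∁p⇒x∉p (proj₂ (x∈p∩q⁻ A _ u∈A₂)) (proj₂ (x∈p∩q⁻ A _ x∈A₁))

  ∣A₁∣≤∣Q∣ : ∣ A₁ ∣ ≤ ∣ Q ∣
  ∣A₁∣≤∣Q∣ = injection⇒∣p∣≤∣q∣ (ExternalPrivateNeighbour T S) total injective
    where
    total : ∀ {x} → x ∈ A₁ → ∃[ w ] (w ∈ Q × ExternalPrivateNeighbour T S x w)
    total x∈A₁ with x∈A , x∈N ← x∈p∩q⁻ A _ x∈A₁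
               with w , epn ← externalPrivateNeighbour T domS x∈N (critical x∈A) =
      w , privateNeighbour∈Q x∈A₁ epn , epn
    injective : ∀ {x x′ w} → x ∈ A₁ → x′ ∈ A₁ → ExternalPrivateNeighbour T S x w →
                ExternalPrivateNeighbour T S x′ w → x ≡ x′
    injective _ x′∈A₁ (_ , _ , onlyX) (_ , x′~w , _) = sym (onlyX (A⊆S (proj₁ (x∈p∩q⁻ A _ x′∈A₁))) x′~w)

  ∣A∣+∣S∣≤∣I∣+∣I∣ : ∣ A ∣ + ∣ S ∣ ≤ ∣ I false ∣ + ∣ I true ∣
  ∣A∣+∣S∣≤∣I∣+∣I∣ = +-cancelʳ-≤ ∣ Q ∣ _ _ (begin
    ∣ A ∣ + ∣ S ∣ + ∣ Q ∣                ≡⟨ +-assoc ∣ A ∣ _ _ ⟩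
    ∣ A ∣ + (∣ S ∣ + ∣ Q ∣)              ≡⟨ cong (∣ A ∣ +_) (sym S∪Q-size) ⟩
    ∣ A ∣ + ∣ S ∪ Q ∣                    ≤⟨ +-mono-≤ A-size (p⊆q⇒∣p∣≤∣q∣ S∪Q⊆I∪I) ⟩
    ∣ A₁ ∣ + ∣ A₂ ∣ + ∣ I₀ ∪ I₁ ∣        ≤⟨ +-monoˡ-≤ _ (+-mono-≤ ∣A₁∣≤∣Q∣ (p⊆q⇒∣p∣≤∣q∣ A₂⊆I∩I)) ⟩
    ∣ Q ∣ + ∣ I₀ ∩ I₁ ∣ + ∣ I₀ ∪ I₁ ∣    ≡⟨ +-assoc ∣ Q ∣ _ _ ⟩
    ∣ Q ∣ + (∣ I₀ ∩ I₁ ∣ + ∣ I₀ ∪ I₁ ∣)  ≡⟨ cong (∣ Q ∣ +_) (∣p∩q∣+∣p∪q∣≡∣p∣+∣q∣ I₀ I₁) ⟩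
    ∣ Q ∣ + (∣ I₀ ∣ + ∣ I₁ ∣)            ≡⟨ +-comm ∣ Q ∣ _ ⟩
    ∣ I₀ ∣ + ∣ I₁ ∣ + ∣ Q ∣              ∎)
    where
    open ≤-Reasoning
    I₀ I₁ : Subset n
    I₀ = I false
    I₁ = I true
    S∪Q-size : ∣ S ∪ Q ∣ ≡ ∣ S ∣ + ∣ Q ∣
    S∪Q-size = Empty[p∩q]⇒∣p∪q∣≡∣p∣+∣q∣ S Q S∩Q-empty
    A-size : ∣ A ∣ ≤ ∣ A₁ ∣ + ∣ A₂ ∣
    A-size = ≤-trans (p⊆q⇒∣p∣≤∣q∣ A⊆A₁∪A₂) (∣p∪q∣≤∣p∣+∣q∣ A₁ A₂)

lemma15 : ∀ (n : ℕ) (T : Graph n) → IsTree T →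
          ∀ (Γ : ℕ) → IsUpperDomination T Γ →
          ∀ (S : Subset n) → Dominating T S →
          ∀ (A : Subset n) → IsA T S A →
          ∣ A ∣ + ∣ S ∣ ≤ 2 * Γ
lemma15 n T isTree Γ (_ , maxΓ) S domS A isA with colour , proper ← tree⇒bipartite T isTree = begin
  ∣ A ∣ + ∣ S ∣              ≤⟨ ∣A∣+∣S∣≤∣I∣+∣I∣ ⟩
  ∣ I false ∣ + ∣ I true ∣   ≤⟨ +-mono-≤ (∣independent∣≤Γ T maxΓ (I-independent false))
                                         (∣independent∣≤Γ T maxΓ (I-independent true)) ⟩
  Γ + Γ                      ≡⟨ cong (Γ +_) (sym (+-identityʳ Γ)) ⟩
  2 * Γ                      ∎
  where
  open CriticalVertices T S domS A isA colour proper
  open ≤-Reasoning
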